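{- For every finite integer $k\ge6$ and for $k=\infty$, every locally optimal nowhere-zero $6$-flow is a $3$-approximation to $\operatorname{SWNZF}(k)$, i.e., its cost is at most $3$ times the minimum cost of a nowhere-zero $k$-flow (a nowhere-zero flow, if $k=\infty$).
   Context: Let $G=(V,E)$ be a 2-edge-connected undirected graph with bidirected graph having arcs $e^+,e^-$ per edge, and symmetric costs $c:E^+\cup E^-\to\mathbb{Z}_{\ge0}$ ($c(e^+)=c(e^-)$ for all $e$). For an integer $k\ge2$, a nowhere-zero $k$-flow is a pair $(\vec E,f)$ where $\vec E$ is an orientation of $E$ and $f:\vec E\to\{1,\dots,k-1\}$ satisfies flow conservation at every vertex; a nowhere-zero flow is one for some finite $k$. Its cost is $c(f)=\sum_{e\in\vec E}c(e)f(e)$. $\operatorname{SWNZF}(k)$ asks for a minimum-cost nowhere-zero $k$-flow. A nowhere-zero $6$-flow $(\vec E,f)$ is locally optimal if for every directed cycle $C\subseteq\vec E$, $\sum_{e\in C}c(e)f(e)\le 3\sum_{e\in C}c(e)$. -}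

module Defs where

open import Data.Nat using (ℕ; zero; suc; _+_; _*_; _≤_; _<_)
open import Data.Fin using (Fin; zero; suc; inject₁; fromℕ)
open import Data.Bool using (Bool; true; false; if_then_else_)
open import Data.Maybe using (Maybe; just; nothing)
open import Data.Product using (_×_; Σ)
open import Relation.Binary.PropositionalEquality using (_≡_; _≢_)
open import Relation.Nullary using (¬_)
open import Relation.Nullary.Decidable using (⌊_⌋)
open import Data.Fin using (_≟_)
open import Function.Definitions using (Injective)
open import Data.Unit using (⊤)

sumFin : (m : ℕ) → (Fin m → ℕ) → ℕ
sumFin zero    f = 0
sumFin (suc m) f = f zero + sumFin m (λ i → f (suc i))

-- Each edge e has endpoints end₁ e and end₂ e (the reference orientation
-- end₁ → end₂ is used only to name the two arcs e⁺ = (end₁→end₂) and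
-- e⁻ = (end₂→end₁) of the bidirected graph).
record Graph (n m : ℕ) : Set where
  field
    end₁ : Fin m → Fin n
    end₂ : Fin m → Fin n
open Graph public

data Walk {n m : ℕ} (G : Graph n m) (removed : Maybe (Fin m)) : Fin n → Fin n → Set where
  here : ∀ {v} → Walk G removed v v
  fwd  : ∀ {v} (e : Fin m) → removed ≢ just e →
         Walk G removed (end₂ G e) v → Walk G removed (end₁ G e) v
  bwd  : ∀ {v} (e : Fin m) → removed ≢ just e →
         Walk G removed (end₁ G e) v → Walk G removed (end₂ G e) v

Connected : ∀ {n m} → Graph n m → Set
Connected G = ∀ u v → Walk G nothing u v

TwoEdgeConnected : ∀ {n m} → Graph n m → Set
TwoEdgeConnected {n} {m} G = Connected G × (∀ (e : Fin m) u v → Walk G (just e) u v)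

-- Orientations: o e = true means e is oriented as the arc e⁺ (end₁ → end₂),
-- o e = false means e is oriented as e⁻ (end₂ → end₁).
Orientation : ℕ → Set
Orientation m = Fin m → Bool

tailO : ∀ {n m} → Graph n m → Orientation m → Fin m → Fin n
tailO G o e = if o e then end₁ G e else end₂ G e

headO : ∀ {n m} → Graph n m → Orientation m → Fin m → Fin n
headO G o e = if o e then end₂ G e else end₁ G e

-- Costs on the arcs of the bidirected graph: c true e = c(e⁺), c false e = c(e⁻).
Cost : ℕ → Set
Cost m = Bool → Fin m → ℕ

Symmetric : ∀ {m} → Cost m → Set
Symmetric {m} c = ∀ (e : Fin m) → c true e ≡ c false e

data ℕ∞ : Set where
  fin : ℕ → ℕ∞
  ∞   : ℕ∞

InRange : ℕ∞ → ℕ → Set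
InRange (fin k) x = (1 ≤ x) × (x < k)
InRange ∞       x = 1 ≤ x

inflow : ∀ {n m} → Graph n m → Orientation m → (Fin m → ℕ) → Fin n → ℕ
inflow {m = m} G o f v = sumFin m (λ e → if ⌊ headO G o e ≟ v ⌋ then f e else 0)

outflow : ∀ {n m} → Graph n m → Orientation m → (Fin m → ℕ) → Fin n → ℕ
outflow {m = m} G o f v = sumFin m (λ e → if ⌊ tailO G o e ≟ v ⌋ then f e else 0)

record NZFlow {n m : ℕ} (G : Graph n m) (k : ℕ∞) : Set where
  constructor mkFlow
  field
    orient   : Orientation m
    val      : Fin m → ℕ
    inRange  : ∀ e → InRange k (val e)
    conserve : ∀ v → inflow G orient val v ≡ outflow G orient val v
open NZFlow public

arcCost : ∀ {m} → Cost m → Orientation m → Fin m → ℕ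
arcCost c o e = c (o e) e

flowCost : ∀ {n m} {G : Graph n m} {k : ℕ∞} → Cost m → NZFlow G k → ℕ
flowCost {m = m} c F = sumFin m (λ e → arcCost c (orient F) e * val F e)

record DirCycle {n m : ℕ} (G : Graph n m) (o : Orientation m) : Set where
  field
    len      : ℕ
    edge     : Fin (suc len) → Fin m
    edgeInj  : Injective _≡_ _≡_ edge
    vertInj  : Injective _≡_ _≡_ (λ i → headO G o (edge i))
    chain    : ∀ (i : Fin len) → tailO G o (edge (suc i)) ≡ headO G o (edge (inject₁ i))
    close    : tailO G o (edge zero) ≡ headO G o (edge (fromℕ len))
open DirCycle public

cycleSum : ∀ {n m} {G : Graph n m} {o : Orientation m} → DirCycle G o → (Fin m → ℕ) → ℕ
cycleSum C w = sumFin (suc (len C)) (λ i → w (edge C i))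

LocallyOptimal : ∀ {n m} {G : Graph n m} → Cost m → NZFlow G (fin 6) → Set
LocallyOptimal {G = G} c F =
  ∀ (C : DirCycle G (orient F)) →
    cycleSum C (λ e → arcCost c (orient F) e * val F e)
      ≤ 3 * cycleSum C (arcCost c (orient F))

AtLeast6 : ℕ∞ → Set
AtLeast6 (fin k) = 6 ≤ k
AtLeast6 ∞       = ⊤

-- View the 6-flow f as a circulation on its orientation. Peeling off directed
-- cycles one at a time and applying local optimality to each, with weights c·f
-- against c, gives Σ c f² ≤ 3 Σ c f. Summing c (f − 3)² ≥ 0, i.e.
-- 6 c f ≤ c f² + 9 c, then yields Σ c f ≤ 3 Σ c. Finally Σ c is a lower bound for
-- the cost of every nowhere-zero flow: all its values are at least 1, and by
-- symmetry of c the orientation does not matter.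
module Submission where

open import Defs
open import Data.Bool using (true; false; if_then_else_)
open import Data.Fin using (Fin; zero; suc; inject₁; fromℕ; toℕ; _≟_)
import Data.Fin.Properties as FinP
open import Data.List using ([]; _∷_)
open import Data.Nat using (ℕ; zero; suc; _+_; _*_; _∸_; _≤_; _<_; z≤n; s≤s; s≤s⁻¹; NonZero)
open import Data.Nat.Induction using (Acc; acc; <-wellFounded)
open import Data.Nat.Properties renaming (_≟_ to _≟ℕ_)
open import Data.Nat.Tactic.RingSolver using (solve)
open import Data.Product using (Σ; ∃; _×_; _,_; proj₁; proj₂)
open import Data.Sum using (inj₁; inj₂)
open import Function.Definitions using (Injective)
open import Relation.Binary.Definitions using (tri<; tri≈; tri>)
open import Relation.Binary.PropositionalEquality
open import Relation.Nullary using (yes; no; ¬_; contradiction)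
open import Relation.Nullary.Decidable using (⌊_⌋)
open import Relation.Unary using (Pred; Decidable)

import Algebra.Properties.Semiring.Sum +-*-semiring as Sum

2*m*n≤m*m+n*n : ∀ m n → 2 * (m * n) ≤ m * m + n * n
2*m*n≤m*m+n*n zero    n       = z≤n
2*m*n≤m*m+n*n m       zero    rewrite *-zeroʳ m = z≤n
2*m*n≤m*m+n*n (suc m) (suc n) = begin
  2 * (suc m * suc n)                  ≡⟨ solve (m ∷ n ∷ []) ⟩
  2 * (m * n) + (2 * m + 2 * n + 2)    ≤⟨ +-monoˡ-≤ _ (2*m*n≤m*m+n*n m n) ⟩
  m * m + n * n + (2 * m + 2 * n + 2)  ≡⟨ solve (m ∷ n ∷ []) ⟩
  suc m * suc m + suc n * suc n        ∎
  where open ≤-Reasoning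

least-witness : ∀ {p} {P : Pred ℕ p} → Decidable P → ∀ {j} → P j →
                ∃ λ i → P i × (∀ {k} → k < i → ¬ P k)
least-witness {P = P} P? {j} Pj = go j (<-wellFounded j) Pj
  where
  go : ∀ j → Acc _<_ j → P j → ∃ λ i → P i × (∀ {k} → k < i → ¬ P k)
  go j (acc rs) Pj with anyUpTo? P? j
  ... | yes (k , k<j , Pk) = go k (rs k<j) Pk
  ... | no  none           = j , Pj , λ k<j Pk → none (_ , k<j , Pk)

sumFin≡sum : ∀ m (f : Fin m → ℕ) → sumFin m f ≡ Sum.sum f
sumFin≡sum zero    f = refl
sumFin≡sum (suc m) f = cong (f zero +_) (sumFin≡sum m (λ i → f (suc i)))

sumFin-cong : ∀ m {f g : Fin m → ℕ} → (∀ i → f i ≡ g i) → sumFin m f ≡ sumFin m g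
sumFin-cong zero    f≗g = refl
sumFin-cong (suc m) f≗g = cong₂ _+_ (f≗g zero) (sumFin-cong m (λ i → f≗g (suc i)))

sumFin-mono-≤ : ∀ m {f g : Fin m → ℕ} → (∀ i → f i ≤ g i) → sumFin m f ≤ sumFin m g
sumFin-mono-≤ zero    f≤g = z≤n
sumFin-mono-≤ (suc m) f≤g = +-mono-≤ (f≤g zero) (sumFin-mono-≤ m (λ i → f≤g (suc i)))

sumFin-zero : ∀ m → sumFin m (λ _ → 0) ≡ 0
sumFin-zero zero    = refl
sumFin-zero (suc m) = sumFin-zero m

sumFin-distrib-+ : ∀ m (f g : Fin m → ℕ) →
                   sumFin m (λ i → f i + g i) ≡ sumFin m f + sumFin m g
sumFin-distrib-+ m f g = begin
  sumFin m (λ i → f i + g i)  ≡⟨ sumFin≡sum m _ ⟩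
  Sum.sum (λ i → f i + g i)   ≡⟨ Sum.∑-distrib-+ f g ⟩
  Sum.sum f + Sum.sum g       ≡⟨ cong₂ _+_ (sumFin≡sum m f) (sumFin≡sum m g) ⟨
  sumFin m f + sumFin m g     ∎
  where open ≡-Reasoning

*-distribˡ-sumFin : ∀ m x (f : Fin m → ℕ) → x * sumFin m f ≡ sumFin m (λ i → x * f i)
*-distribˡ-sumFin m x f = begin
  x * sumFin m f            ≡⟨ cong (x *_) (sumFin≡sum m f) ⟩
  x * Sum.sum f             ≡⟨ Sum.*-distribˡ-sum x f ⟩
  Sum.sum (λ i → x * f i)   ≡⟨ sumFin≡sum m _ ⟨
  sumFin m (λ i → x * f i)  ∎
  where open ≡-Reasoning

sumFin-comm : ∀ m k (f : Fin m → Fin k → ℕ) →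
              sumFin m (λ i → sumFin k (f i)) ≡ sumFin k (λ j → sumFin m (λ i → f i j))
sumFin-comm m k f = begin
  sumFin m (λ i → sumFin k (f i))          ≡⟨ sumFin≡sum m _ ⟩
  Sum.sum (λ i → sumFin k (f i))           ≡⟨ Sum.sum-cong-≗ (λ i → sumFin≡sum k (f i)) ⟩
  Sum.sum (λ i → Sum.sum (f i))            ≡⟨ Sum.∑-comm f ⟩
  Sum.sum (λ j → Sum.sum (λ i → f i j))    ≡⟨ Sum.sum-cong-≗ (λ j → sumFin≡sum m (λ i → f i j)) ⟨
  Sum.sum (λ j → sumFin m (λ i → f i j))   ≡⟨ sumFin≡sum k _ ⟨
  sumFin k (λ j → sumFin m (λ i → f i j))  ∎
  where open ≡-Reasoning

sumFin-init-last : ∀ k (f : Fin (suc k) → ℕ) →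
                   sumFin (suc k) f ≡ sumFin k (λ i → f (inject₁ i)) + f (fromℕ k)
sumFin-init-last zero    f = +-comm (f zero) 0
sumFin-init-last (suc k) f =
  trans (cong (f zero +_) (sumFin-init-last k (λ i → f (suc i)))) (sym (+-assoc (f zero) _ _))

sumFin-rotate : ∀ k (f g : Fin (suc k) → ℕ) → (∀ i → f (suc i) ≡ g (inject₁ i)) →
                f zero ≡ g (fromℕ k) → sumFin (suc k) f ≡ sumFin (suc k) g
sumFin-rotate k f g shift wrap = begin
  f zero + sumFin k (λ i → f (suc i))           ≡⟨ cong₂ _+_ wrap (sumFin-cong k shift) ⟩
  g (fromℕ k) + sumFin k (λ i → g (inject₁ i))  ≡⟨ +-comm (g (fromℕ k)) _ ⟩
  sumFin k (λ i → g (inject₁ i)) + g (fromℕ k)  ≡⟨ sumFin-init-last k g ⟨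
  sumFin (suc k) g                              ∎
  where open ≡-Reasoning

term≤sumFin : ∀ m (f : Fin m → ℕ) i → f i ≤ sumFin m f
term≤sumFin (suc m) f zero    = m≤m+n (f zero) _
term≤sumFin (suc m) f (suc i) = ≤-trans (term≤sumFin m (λ j → f (suc j)) i) (m≤n+m _ (f zero))

positive-term : ∀ m (f : Fin m → ℕ) → 1 ≤ sumFin m f → ∃ λ i → 1 ≤ f i
positive-term (suc m) f 1≤Σ with f zero in eq
... | suc _ = zero , subst (1 ≤_) (sym eq) (s≤s z≤n)
... | zero with positive-term m (λ i → f (suc i)) 1≤Σ
...   | i , 1≤fi = suc i , 1≤fi

sumFin≤1 : ∀ m (f : Fin m → ℕ) → (∀ i → f i ≤ 1) →
           (∀ i j → 1 ≤ f i → 1 ≤ f j → i ≡ j) → sumFin m f ≤ 1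
sumFin≤1 zero    f f≤1 unique = z≤n
sumFin≤1 (suc m) f f≤1 unique with f zero in eq
... | zero  = sumFin≤1 m (λ i → f (suc i)) (λ i → f≤1 (suc i))
                (λ i j p q → FinP.suc-injective (unique (suc i) (suc j) p q))
... | suc x = begin
  suc x + sumFin m (λ i → f (suc i))  ≡⟨ cong (suc x +_) (trans (sumFin-cong m rest≡0) (sumFin-zero m)) ⟩
  suc x + 0                           ≡⟨ +-identityʳ (suc x) ⟩
  suc x                               ≡⟨ eq ⟨
  f zero                              ≤⟨ f≤1 zero ⟩
  1                                   ∎
  where
  open ≤-Reasoning
  rest≡0 : ∀ i → f (suc i) ≡ 0
  rest≡0 i with f (suc i) in eq′
  ... | zero  = refl
  ... | suc _ with () ← unique (suc i) zero (subst (1 ≤_) (sym eq′) (s≤s z≤n))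
                                            (subst (1 ≤_) (sym eq) (s≤s z≤n))

δ : ∀ {k} → Fin k → Fin k → ℕ
δ i j = if ⌊ i ≟ j ⌋ then 1 else 0

if≡δ* : ∀ {k} (i j : Fin k) x → (if ⌊ i ≟ j ⌋ then x else 0) ≡ δ i j * x
if≡δ* i j x with ⌊ i ≟ j ⌋
... | true  = sym (+-identityʳ x)
... | false = refl

δ≤1 : ∀ {k} (i j : Fin k) → δ i j ≤ 1
δ≤1 i j with ⌊ i ≟ j ⌋
... | true  = s≤s z≤n
... | false = z≤n

δ-pos⇒≡ : ∀ {k} (i j : Fin k) → 1 ≤ δ i j → i ≡ j
δ-pos⇒≡ i j 1≤δ with i ≟ j
... | yes i≡j = i≡j
... | no  _   with () ← 1≤δ

δ-refl : ∀ {k} (i : Fin k) → δ i i ≡ 1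
δ-refl i with i ≟ i
... | yes _  = refl
... | no i≢i = contradiction refl i≢i

δ-suc : ∀ {k} (i j : Fin k) → δ (suc i) (suc j) ≡ δ i j
δ-suc i j with i ≟ j
... | yes _ = refl
... | no  _ = refl

sumFin-*-δ : ∀ m (h : Fin m → ℕ) (a : Fin m) → sumFin m (λ e → h e * δ a e) ≡ h a
sumFin-*-δ (suc m) h zero = begin
  h zero * 1 + sumFin m (λ e → h (suc e) * 0)  ≡⟨ cong₂ _+_ (*-identityʳ (h zero))
                                                            (sumFin-cong m (λ e → *-zeroʳ (h (suc e)))) ⟩
  h zero + sumFin m (λ _ → 0)                  ≡⟨ cong (h zero +_) (sumFin-zero m) ⟩
  h zero + 0                                   ≡⟨ +-identityʳ (h zero) ⟩
  h zero                                       ∎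
  where open ≡-Reasoning
sumFin-*-δ (suc m) h (suc a) rewrite *-zeroʳ (h zero) =
  trans (sumFin-cong m (λ e → cong (h (suc e) *_) (δ-suc a e))) (sumFin-*-δ m (λ e → h (suc e)) a)

count : ∀ {k m} → (Fin k → Fin m) → Fin m → ℕ
count {k} γ e = sumFin k (λ i → δ (γ i) e)

sumFin-*-count : ∀ {k} m (γ : Fin k → Fin m) (h : Fin m → ℕ) →
                 sumFin m (λ e → h e * count γ e) ≡ sumFin k (λ i → h (γ i))
sumFin-*-count {k} m γ h = begin
  sumFin m (λ e → h e * count γ e)                   ≡⟨ sumFin-cong m (λ e → *-distribˡ-sumFin k (h e) _) ⟩
  sumFin m (λ e → sumFin k (λ i → h e * δ (γ i) e))  ≡⟨ sumFin-comm m k _ ⟩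
  sumFin k (λ i → sumFin m (λ e → h e * δ (γ i) e))  ≡⟨ sumFin-cong k (λ i → sumFin-*-δ m h (γ i)) ⟩
  sumFin k (λ i → h (γ i))                           ∎
  where open ≡-Reasoning

count≤1 : ∀ {k m} (γ : Fin k → Fin m) → Injective _≡_ _≡_ γ → ∀ e → count γ e ≤ 1
count≤1 {k} γ γ-inj e = sumFin≤1 k _ (λ i → δ≤1 (γ i) e)
  (λ i j 1≤δi 1≤δj → γ-inj (trans (δ-pos⇒≡ (γ i) e 1≤δi) (sym (δ-pos⇒≡ (γ j) e 1≤δj))))

count-pos⇒∈ : ∀ {k m} (γ : Fin k → Fin m) e → 1 ≤ count γ e → ∃ λ i → γ i ≡ e
count-pos⇒∈ {k} γ e 1≤c with positive-term k _ 1≤c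
... | i , 1≤δ = i , δ-pos⇒≡ (γ i) e 1≤δ

-- inflow G o and outflow G o are, definitionally, through (headO G o) and through (tailO G o).
through : ∀ {n m} → (Fin m → Fin n) → (Fin m → ℕ) → Fin n → ℕ
through {m = m} end g v = sumFin m (λ e → if ⌊ end e ≟ v ⌋ then g e else 0)

through-+ : ∀ {n m} (end : Fin m → Fin n) (g h : Fin m → ℕ) v →
            through end (λ e → g e + h e) v ≡ through end g v + through end h v
through-+ {m = m} end g h v = trans (sumFin-cong m split) (sumFin-distrib-+ m _ _)
  where
  split : ∀ e → (if ⌊ end e ≟ v ⌋ then g e + h e else 0)
              ≡ (if ⌊ end e ≟ v ⌋ then g e else 0) + (if ⌊ end e ≟ v ⌋ then h e else 0)
  split e with ⌊ end e ≟ v ⌋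
  ... | true  = refl
  ... | false = refl

through-count : ∀ {n m k} (end : Fin m → Fin n) (γ : Fin k → Fin m) v →
                through end (count γ) v ≡ sumFin k (λ i → δ (end (γ i)) v)
through-count {m = m} {k} end γ v = begin
  through end (count γ) v                   ≡⟨ sumFin-cong m (λ e → if≡δ* (end e) v (count γ e)) ⟩
  sumFin m (λ e → δ (end e) v * count γ e)  ≡⟨ sumFin-*-count m γ (λ e → δ (end e) v) ⟩
  sumFin k (λ i → δ (end (γ i)) v)          ∎
  where open ≡-Reasoning

≤-through : ∀ {n m} (end : Fin m → Fin n) (g : Fin m → ℕ) e → g e ≤ through end g (end e)
≤-through {m = m} end g e = subst (_≤ through end g (end e)) select-self (term≤sumFin m _ e)
  where
  select-self : (if ⌊ end e ≟ end e ⌋ then g e else 0) ≡ g e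
  select-self = trans (if≡δ* (end e) (end e) (g e))
                      (trans (cong (_* g e) (δ-refl (end e))) (*-identityˡ (g e)))

through-pos : ∀ {n m} (end : Fin m → Fin n) (g : Fin m → ℕ) v →
              1 ≤ through end g v → ∃ λ e → 1 ≤ g e × end e ≡ v
through-pos {m = m} end g v 1≤Σ with positive-term m _ 1≤Σ
... | e , 1≤term with end e ≟ v
...   | yes end≡v = e , 1≤term , end≡v
...   | no  _     with () ← 1≤term

module _ {n m} (G : Graph n m) (o : Orientation m) where

  IsCirculation : (Fin m → ℕ) → Set
  IsCirculation g = ∀ v → inflow G o g v ≡ outflow G o g v

  circulation-∸ : ∀ g h → IsCirculation g → IsCirculation h → (∀ e → h e ≤ g e) →
                  IsCirculation (λ e → g e ∸ h e)
  circulation-∸ g h g-circ h-circ h≤g v = +-cancelʳ-≡ (inflow G o h v) _ _ (begin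
    inflow G o g′ v + inflow G o h v    ≡⟨ through-+ (headO G o) g′ h v ⟨
    inflow G o (λ e → g′ e + h e) v     ≡⟨ sumFin-cong m (λ e → cong (at (headO G o) e) (m∸n+n≡m (h≤g e))) ⟩
    inflow G o g v                      ≡⟨ g-circ v ⟩
    outflow G o g v                     ≡⟨ sumFin-cong m (λ e → cong (at (tailO G o) e) (m∸n+n≡m (h≤g e))) ⟨
    outflow G o (λ e → g′ e + h e) v    ≡⟨ through-+ (tailO G o) g′ h v ⟩
    outflow G o g′ v + outflow G o h v  ≡⟨ cong (outflow G o g′ v +_) (h-circ v) ⟨
    outflow G o g′ v + inflow G o h v   ∎)
    where
    open ≡-Reasoning
    g′ : Fin m → ℕ
    g′ e = g e ∸ h e
    at : (Fin m → Fin n) → Fin m → ℕ → ℕ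
    at end e x = if ⌊ end e ≟ v ⌋ then x else 0

  cycle-isCirculation : (C : DirCycle G o) → IsCirculation (count (edge C))
  cycle-isCirculation C v = begin
    inflow G o (count (edge C)) v   ≡⟨ through-count (headO G o) (edge C) v ⟩
    sumFin (suc (len C)) at-head    ≡⟨ sumFin-rotate (len C) at-tail at-head (λ i → cong (λ x → δ x v) (chain C i))
                                                                             (cong (λ x → δ x v) (close C)) ⟨
    sumFin (suc (len C)) at-tail    ≡⟨ through-count (tailO G o) (edge C) v ⟨
    outflow G o (count (edge C)) v  ∎
    where
    open ≡-Reasoning
    at-head at-tail : Fin (suc (len C)) → ℕ
    at-head i = δ (headO G o (edge C i)) v
    at-tail i = δ (tailO G o (edge C i)) v

  segment-cycle : (E : ℕ → Fin m) → (∀ t → tailO G o (E (suc t)) ≡ headO G o (E t)) →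
                  ∀ i L → headO G o (E i) ≡ headO G o (E (suc (i + L))) →
                  (∀ a b → a < b → b ≤ L → headO G o (E (suc (i + a))) ≢ headO G o (E (suc (i + b)))) →
                  DirCycle G o
  segment-cycle E E-chain i L closes distinct = record
    { len     = L
    ; edge    = ed
    ; edgeInj = λ eq → heads-inj (cong (headO G o) eq)
    ; vertInj = heads-inj
    ; chain   = λ t → begin
        tailO G o (E (suc (i + suc (toℕ t))))  ≡⟨ cong (λ x → tailO G o (E (suc x))) (+-suc i (toℕ t)) ⟩
        tailO G o (E (suc (suc (i + toℕ t))))  ≡⟨ E-chain (suc (i + toℕ t)) ⟩
        headO G o (E (suc (i + toℕ t)))        ≡⟨ cong (λ x → headO G o (E (suc (i + x)))) (FinP.toℕ-inject₁ t) ⟨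
        headO G o (ed (inject₁ t))             ∎
    ; close   = begin
        tailO G o (E (suc (i + 0)))            ≡⟨ cong (λ x → tailO G o (E (suc x))) (+-identityʳ i) ⟩
        tailO G o (E (suc i))                  ≡⟨ E-chain i ⟩
        headO G o (E i)                        ≡⟨ closes ⟩
        headO G o (E (suc (i + L)))            ≡⟨ cong (λ x → headO G o (E (suc (i + x)))) (FinP.toℕ-fromℕ L) ⟨
        headO G o (ed (fromℕ L))               ∎
    }
    where
    open ≡-Reasoning
    ed : Fin (suc L) → Fin m
    ed t = E (suc (i + toℕ t))
    heads-inj : ∀ {a b} → headO G o (ed a) ≡ headO G o (ed b) → a ≡ b
    heads-inj {a} {b} eq with <-cmp (toℕ a) (toℕ b)
    ... | tri< a<b _ _ = contradiction eq (distinct (toℕ a) (toℕ b) a<b (s≤s⁻¹ (FinP.toℕ<n b)))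
    ... | tri≈ _ a≡b _ = FinP.toℕ-injective a≡b
    ... | tri> _ _ b<a = contradiction (sym eq) (distinct (toℕ b) (toℕ a) b<a (s≤s⁻¹ (FinP.toℕ<n a)))

  -- Following successors forever, two of the first n + 1 heads coincide (pigeonhole);
  -- the earliest repeated head closes a cycle on which all heads are distinct.
  module SuccessorWalk (S : Fin m → Set) (next : ∀ e → S e → ∃ λ e′ → S e′ × tailO G o e′ ≡ headO G o e)
                       (e₀ : Fin m) (s₀ : S e₀) where

    walk : ℕ → Σ (Fin m) S
    walk zero    = e₀ , s₀
    walk (suc t) = let (e′ , s′ , _) = next (proj₁ (walk t)) (proj₂ (walk t)) in e′ , s′

    E : ℕ → Fin m
    E t = proj₁ (walk t)

    E-chain : ∀ t → tailO G o (E (suc t)) ≡ headO G o (E t)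
    E-chain t = proj₂ (proj₂ (next (proj₁ (walk t)) (proj₂ (walk t))))

    h : ℕ → Fin n
    h t = headO G o (E t)

    Repeat : ℕ → Set
    Repeat j = ∃ λ i → i < j × h i ≡ h j

    repeat? : Decidable Repeat
    repeat? j = anyUpTo? (λ i → h i ≟ h j) j

    some-repeat : ∃ Repeat
    some-repeat with FinP.pigeonhole (n<1+n n) (λ t → h (toℕ t))
    ... | a , b , a<b , ha≡hb = toℕ b , toℕ a , a<b , ha≡hb

    cycle : Σ (DirCycle G o) (λ C → ∀ t → S (edge C t))
    cycle with least-witness repeat? (proj₂ some-repeat)
    ... | j , (i , i<j , hi≡hj) , earlier with m≤n⇒∃[o]m+o≡n i<j
    ...   | L , refl = segment-cycle E E-chain i L hi≡hj distinct , λ t → proj₂ (walk (suc (i + toℕ t)))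
      where
      distinct : ∀ a b → a < b → b ≤ L → h (suc (i + a)) ≢ h (suc (i + b))
      distinct a b a<b b≤L eq with m≤n⇒m<n∨m≡n b≤L
      ... | inj₁ b<L  = earlier (s≤s (+-monoʳ-< i b<L)) (suc (i + a) , s≤s (+-monoʳ-< i a<b) , eq)
      ... | inj₂ refl = earlier (s≤s (+-monoʳ-< i a<b)) (i , s≤s (m≤m+n i a) , trans hi≡hj (sym eq))

  successor-closed-cycle : (S : Fin m → Set) →
                           (∀ e → S e → ∃ λ e′ → S e′ × tailO G o e′ ≡ headO G o e) →
                           ∀ e → S e → Σ (DirCycle G o) (λ C → ∀ t → S (edge C t))
  successor-closed-cycle S next e₀ s₀ = SuccessorWalk.cycle S next e₀ s₀

  support-cycle : ∀ g → IsCirculation g → ∀ e → 1 ≤ g e →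
                  Σ (DirCycle G o) (λ C → ∀ t → 1 ≤ g (edge C t))
  support-cycle g g-circ = successor-closed-cycle (λ e → 1 ≤ g e) next
    where
    next : ∀ e → 1 ≤ g e → ∃ λ e′ → 1 ≤ g e′ × tailO G o e′ ≡ headO G o e
    next e 1≤ge = through-pos (tailO G o) g (headO G o e)
      (subst (1 ≤_) (g-circ (headO G o e)) (≤-trans 1≤ge (≤-through (headO G o) g e)))

  cycle-count≤ : (C : DirCycle G o) (g : Fin m → ℕ) → (∀ t → 1 ≤ g (edge C t)) →
                 ∀ e → count (edge C) e ≤ g e
  cycle-count≤ C g C⊆g e with count (edge C) e in eq
  ... | zero  = z≤n
  ... | suc _ with count-pos⇒∈ (edge C) e (subst (1 ≤_) (sym eq) (s≤s z≤n))
  ...   | t , refl = ≤-trans (subst (_≤ 1) eq (count≤1 (edge C) (edgeInj C) e)) (C⊆g t)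

  residual : DirCycle G o → (Fin m → ℕ) → Fin m → ℕ
  residual C g e = g e ∸ count (edge C) e

  residual-isCirculation : (C : DirCycle G o) (g : Fin m → ℕ) → (∀ t → 1 ≤ g (edge C t)) →
                           IsCirculation g → IsCirculation (residual C g)
  residual-isCirculation C g C⊆g g-circ =
    circulation-∸ g (count (edge C)) g-circ (cycle-isCirculation C) (cycle-count≤ C g C⊆g)

  sumFin-*-residual : (C : DirCycle G o) (g : Fin m → ℕ) → (∀ t → 1 ≤ g (edge C t)) → ∀ h →
                      sumFin m (λ e → h e * g e) ≡ sumFin m (λ e → h e * residual C g e) + cycleSum C h
  sumFin-*-residual C g C⊆g h = begin
    sumFin m (λ e → h e * g e)                   ≡⟨ sumFin-cong m (λ e → cong (h e *_) (m∸n+n≡m (χ≤g e))) ⟨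
    sumFin m (λ e → h e * (g′ e + χ e))          ≡⟨ sumFin-cong m (λ e → *-distribˡ-+ (h e) (g′ e) (χ e)) ⟩
    sumFin m (λ e → h e * g′ e + h e * χ e)      ≡⟨ sumFin-distrib-+ m _ _ ⟩
    Σhg′ + sumFin m (λ e → h e * χ e)            ≡⟨ cong (Σhg′ +_) (sumFin-*-count m (edge C) h) ⟩
    Σhg′ + cycleSum C h                          ∎
    where
    open ≡-Reasoning
    χ g′ : Fin m → ℕ
    χ  = count (edge C)
    g′ = residual C g
    χ≤g : ∀ e → χ e ≤ g e
    χ≤g = cycle-count≤ C g C⊆g
    Σhg′ : ℕ
    Σhg′ = sumFin m (λ e → h e * g′ e)

  residual-smaller : (C : DirCycle G o) (g : Fin m → ℕ) → (∀ t → 1 ≤ g (edge C t)) →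
                     sumFin m (residual C g) < sumFin m g
  residual-smaller C g C⊆g = begin-strict
    sumFin m (residual C g)                        <⟨ m<m+n _ (s≤s z≤n) ⟩
    sumFin m (residual C g) + ones                 ≡⟨ cong (_+ ones) (sumFin-cong m (λ e → *-identityˡ _)) ⟨
    sumFin m (λ e → 1 * residual C g e) + ones     ≡⟨ sumFin-*-residual C g C⊆g (λ _ → 1) ⟨
    sumFin m (λ e → 1 * g e)                       ≡⟨ sumFin-cong m (λ e → *-identityˡ (g e)) ⟩
    sumFin m g                                     ∎
    where
    open ≤-Reasoning
    ones : ℕ
    ones = cycleSum C (λ _ → 1)

  cycle-bound⇒circulation-bound : ∀ r (w a : Fin m → ℕ) → (∀ C → cycleSum C w ≤ r * cycleSum C a) →
    ∀ g → IsCirculation g → sumFin m (λ e → w e * g e) ≤ r * sumFin m (λ e → a e * g e)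
  cycle-bound⇒circulation-bound r w a cycle-bound g g-circ = go g g-circ (<-wellFounded (sumFin m g))
    where
    open ≤-Reasoning
    go : ∀ g → IsCirculation g → Acc _<_ (sumFin m g) →
         sumFin m (λ e → w e * g e) ≤ r * sumFin m (λ e → a e * g e)
    go g g-circ (acc rs) with FinP.all? (λ e → g e ≟ℕ 0)
    ... | yes g≡0 = begin
      sumFin m (λ e → w e * g e)      ≡⟨ sumFin-cong m (λ e → cong (w e *_) (g≡0 e)) ⟩
      sumFin m (λ e → w e * 0)        ≡⟨ trans (sumFin-cong m (λ e → *-zeroʳ (w e))) (sumFin-zero m) ⟩
      0                               ≤⟨ z≤n ⟩
      r * sumFin m (λ e → a e * g e)  ∎
    ... | no  g≢0 =
      let e₀ , ge₀≢0 = FinP.¬∀⟶∃¬ m _ (λ e → g e ≟ℕ 0) g≢0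
          C , C⊆g    = support-cycle g g-circ e₀ (n≢0⇒n>0 ge₀≢0)
          g′         = residual C g
          g′-bound   = go g′ (residual-isCirculation C g C⊆g g-circ) (rs (residual-smaller C g C⊆g))
      in begin
      sumFin m (λ e → w e * g e)                          ≡⟨ sumFin-*-residual C g C⊆g w ⟩
      sumFin m (λ e → w e * g′ e) + cycleSum C w          ≤⟨ +-mono-≤ g′-bound (cycle-bound C) ⟩
      r * sumFin m (λ e → a e * g′ e) + r * cycleSum C a  ≡⟨ *-distribˡ-+ r _ _ ⟨
      r * (sumFin m (λ e → a e * g′ e) + cycleSum C a)    ≡⟨ cong (r *_) (sumFin-*-residual C g C⊆g a) ⟨
      r * sumFin m (λ e → a e * g e)                      ∎

  locally-optimal⇒cost-bound : ∀ r .{{_ : NonZero r}} (a f : Fin m → ℕ) → IsCirculation f →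
                               (∀ C → cycleSum C (λ e → a e * f e) ≤ r * cycleSum C a) →
                               sumFin m (λ e → a e * f e) ≤ r * sumFin m a
  locally-optimal⇒cost-bound r a f f-circ locally-optimal =
    *-cancelˡ-≤ r (+-cancelˡ-≤ (r * S₁) _ _ (begin
      r * S₁ + r * S₁       ≡⟨ *-distribʳ-+ S₁ r r ⟨
      (r + r) * S₁          ≤⟨ am-gm-bound ⟩
      S₂ + (r * r) * A      ≤⟨ +-monoˡ-≤ _ quadratic-bound ⟩
      r * S₁ + (r * r) * A  ≡⟨ cong (r * S₁ +_) (*-assoc r r A) ⟩
      r * S₁ + r * (r * A)  ∎))
    where
    open ≤-Reasoning
    S₁ S₂ A : ℕ
    S₁ = sumFin m (λ e → a e * f e)
    S₂ = sumFin m (λ e → a e * f e * f e)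
    A  = sumFin m a
    quadratic-bound : S₂ ≤ r * S₁
    quadratic-bound = cycle-bound⇒circulation-bound r (λ e → a e * f e) a locally-optimal f f-circ
    pointwise : ∀ x y → (r + r) * (x * y) ≤ x * y * y + (r * r) * x
    pointwise x y = begin
      (r + r) * (x * y)        ≡⟨ solve (r ∷ x ∷ y ∷ []) ⟩
      x * (2 * (r * y))        ≤⟨ *-monoʳ-≤ x (2*m*n≤m*m+n*n r y) ⟩
      x * (r * r + y * y)      ≡⟨ solve (r ∷ x ∷ y ∷ []) ⟩
      x * y * y + (r * r) * x  ∎
    am-gm-bound : (r + r) * S₁ ≤ S₂ + (r * r) * A
    am-gm-bound = begin
      (r + r) * S₁                                      ≡⟨ *-distribˡ-sumFin m (r + r) _ ⟩
      sumFin m (λ e → (r + r) * (a e * f e))            ≤⟨ sumFin-mono-≤ m (λ e → pointwise (a e) (f e)) ⟩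
      sumFin m (λ e → a e * f e * f e + (r * r) * a e)  ≡⟨ sumFin-distrib-+ m _ _ ⟩
      S₂ + sumFin m (λ e → (r * r) * a e)               ≡⟨ cong (S₂ +_) (*-distribˡ-sumFin m (r * r) a) ⟨
      S₂ + (r * r) * A                                  ∎

inRange⇒positive : ∀ k x → InRange k x → 1 ≤ x
inRange⇒positive (fin k) x (1≤x , _) = 1≤x
inRange⇒positive ∞       x 1≤x       = 1≤x

symmetric⇒arcCost-≡ : ∀ {m} (c : Cost m) → Symmetric c → ∀ o o′ e → arcCost c o e ≡ arcCost c o′ e
symmetric⇒arcCost-≡ c c-sym o o′ e with o e | o′ e
... | true  | true  = refl
... | true  | false = c-sym e
... | false | true  = sym (c-sym e)
... | false | false = refl

total-cost≤flowCost : ∀ {n m} {G : Graph n m} {k} (c : Cost m) → Symmetric c → (o : Orientation m) →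
                      (H : NZFlow G k) → sumFin m (arcCost c o) ≤ flowCost c H
total-cost≤flowCost {m = m} {k = k} c c-sym o H = sumFin-mono-≤ m λ e → begin
  arcCost c o e                     ≡⟨ symmetric⇒arcCost-≡ c c-sym o (orient H) e ⟩
  arcCost c (orient H) e            ≡⟨ *-identityʳ _ ⟨
  arcCost c (orient H) e * 1        ≤⟨ *-monoʳ-≤ (arcCost c (orient H) e) (inRange⇒positive k (val H e) (inRange H e)) ⟩
  arcCost c (orient H) e * val H e  ∎
  where open ≤-Reasoning

-- Nor is the bound f < 6 on the values of F.
lemma6p2 : ∀ {n m : ℕ} (G : Graph n m) → TwoEdgeConnected G →
    (c : Cost m) → Symmetric c →
    (k : ℕ∞) → AtLeast6 k →
    (F : NZFlow G (fin 6)) → LocallyOptimal c F →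
    (H : NZFlow G k) → flowCost c F ≤ 3 * flowCost c H
lemma6p2 {m = m} G _ c c-sym k _ F F-optimal H = begin
  flowCost c F                ≤⟨ locally-optimal⇒cost-bound G o 3 (arcCost c o) (val F) (conserve F) F-optimal ⟩
  3 * sumFin m (arcCost c o)  ≤⟨ *-monoʳ-≤ 3 (total-cost≤flowCost c c-sym o H) ⟩
  3 * flowCost c H            ∎
  where
  open ≤-Reasoning
  o : Orientation m
  o = orient F
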